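{- Up to isomorphism, $\mathbf C_2$, $\mathbf C_3$ and the Klein four-group $\mathbf C_2\times\mathbf C_2$ are the only non-trivial finite groups $\mathbf G$ for which $|\Aut(\mathcal G_e(\mathbf G))|$ is square free.
   Context: The enhanced power graph $\mathcal G_e(\mathbf G)$ of a group $\mathbf G$ is the simple graph on $G$ in which distinct $x,y$ are adjacent iff there is $z\in G$ with $x,y\in\langle z\rangle$. $\mathbf C_n$ is the cyclic group of order $n$. -}

module Defs where

open import Level using (0ℓ)
open import Data.Nat using (ℕ; zero; suc; _*_; _+_; _<_; NonZero)
open import Data.Nat.Divisibility using (_∣_)
open import Data.Nat.DivMod using (_mod_)
open import Data.Fin using (Fin; toℕ)
open import Data.Product using (Σ; ∃; ∃-syntax; _×_; _,_; proj₁)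
open import Relation.Nullary using (¬_)
open import Relation.Binary.PropositionalEquality as P using (_≡_)
open import Relation.Binary.Bundles using (Setoid)
open import Algebra.Structures using (IsGroup)
open import Function.Bundles using (Inverse; _↔_; _⇔_)
open import Function.Definitions using (Bijective)

-- A finite group of order n, with carrier Fin n (every finite group is
-- isomorphic to one of this form).
record FinGroup (n : ℕ) : Set where
  field
    _∙_     : Fin n → Fin n → Fin n
    ε       : Fin n
    _⁻¹     : Fin n → Fin n
    isGroup : IsGroup _≡_ _∙_ ε _⁻¹

module _ {n : ℕ} (G : FinGroup n) where
  open FinGroup G

  pow : Fin n → ℕ → Fin n
  pow z zero    = ε
  pow z (suc k) = z ∙ pow z k

  -- x ∈ ⟨z⟩ (in a finite group the cyclic subgroup is the set of natural powers)
  InCyclic : Fin n → Fin n → Set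
  InCyclic x z = ∃[ k ] (pow z k ≡ x)

  Adj : Fin n → Fin n → Set
  Adj x y = (¬ x ≡ y) × (∃[ z ] (InCyclic x z × InCyclic y z))

  IsGraphAut : (Fin n → Fin n) → Set
  IsGraphAut f = Bijective _≡_ _≡_ f × (∀ x y → Adj x y ⇔ Adj (f x) (f y))

  AutSetoid : Setoid 0ℓ 0ℓ
  AutSetoid = record
    { Carrier = Σ (Fin n → Fin n) IsGraphAut
    ; _≈_ = λ a b → ∀ x → proj₁ a x ≡ proj₁ b x
    ; isEquivalence = record
      { refl = λ x → P.refl
      ; sym = λ p x → P.sym (p x)
      ; trans = λ p q x → P.trans (p x) (q x) } }

  IsoTo : (A : Set) → (A → A → A) → Set
  IsoTo A _·_ = Σ (Fin n ↔ A) λ φ →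
    ∀ x y → Inverse.to φ (x ∙ y) ≡ Inverse.to φ x · Inverse.to φ y

HasCard : Setoid 0ℓ 0ℓ → ℕ → Set
HasCard S k = Inverse S (P.setoid (Fin k))

SquareFree : ℕ → Set
SquareFree k = ∀ d → d * d ∣ k → d ≡ 1

AutCardSquareFree : ∀ {n} → FinGroup n → Set
AutCardSquareFree G = ∃[ k ] (HasCard (AutSetoid G) k × SquareFree k)

addC : (m : ℕ) .{{_ : NonZero m}} → Fin m → Fin m → Fin m
addC m a b = (toℕ a + toℕ b) mod m

kleinOp : Fin 2 × Fin 2 → Fin 2 × Fin 2 → Fin 2 × Fin 2
kleinOp (a , b) (c , d) = addC 2 a c , addC 2 b d

{-# OPTIONS --safe #-}
module Submission where

-- If |Aut(G_e(G))| is square free, G_e(G) cannot contain two disjoint pairs of twins {a, b}, {c, d}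
-- (vertices with the same neighbours apart from each other): the transpositions (a b) and (c d) are
-- commuting automorphisms generating a Klein four-group, which acts freely on Aut(G_e(G)) by left
-- multiplication, so 4 divides |Aut(G_e(G))|.  Twins are plentiful in enhanced power graphs: x and
-- x⁻¹ are twins, any two vertices of a complete graph are twins, and so are any two pendant vertices
-- hanging from the identity.  If some x has x² ≠ ε, this forces first every element outside ⟨x⟩ to
-- be an involution, then G = ⟨x⟩ (an involution y outside would make y and xy pendant), and then
-- x³ = ε (otherwise ε, x, x², x³ are four distinct vertices of a complete graph): G ≅ C₃.  If G has
-- exponent 2 its graph is a star centred at ε, and four non-identity elements are impossible, which
-- leaves C₂ and C₂ × C₂.  Conversely the graphs of C₂, C₃ and C₂ × C₂ are K₂, K₃ and K_{1,3}, whose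
-- automorphism groups have orders 2, 6 and 6.

open import Defs
open import Level using (0ℓ)
open import Data.Nat using (ℕ; zero; suc; _+_; _*_; _<_; _≤_; _!; NonZero; s≤s; z≤n)
open import Data.Nat.Properties as ℕ
  using (m<n+m; m≤n⇒∃[o]m+o≡n; n<1+n; +-suc; <-cmp; <-trans; m≤n+m; ≤-<-trans; m≤m*n; ≤-trans; allUpTo?)
open import Data.Nat.Divisibility using (_∣_; _∣?_; ∣m∣n⇒∣m+n; ∣-refl; _∣0; ∣⇒≤)
open import Data.Nat.DivMod using (_mod_; _/_; _divMod_; DivMod)
open import Data.Nat.Induction using (<-rec)
open import Data.Fin using (Fin; toℕ; _≟_; fromℕ<; punchIn; punchOut)
open import Data.Fin.Patterns using (0F; 1F; 2F)
open import Data.Fin.Properties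
  using (pigeonhole; any?; all?; ¬∀⟶∃¬; toℕ<n; toℕ-injective; toℕ-fromℕ<; punchOut-cong; *↔×)
open import Data.Fin.Permutation as Perm
  using (Permutation′; _⟨$⟩ʳ_; insert; remove; insert-remove; remove-insert; lift₀; lift₀-cong; lift₀-remove; ↔⇒≡)
open import Data.Fin.Permutation.Components using (transpose)
open import Data.List using (List; []; _∷_; length; filter; allFin; tabulate)
open import Data.List.Properties using (filter-all; length-tabulate)
open import Data.List.Relation.Unary.All as All using (All; []; _∷_)
open import Data.List.Relation.Unary.Any using (here; there)
open import Data.List.Relation.Unary.Unique.Propositional using (Unique; []; _∷_)
open import Data.List.Relation.Unary.Unique.Propositional.Properties using (filter⁺; allFin⁺; tabulate⁺)
open import Data.List.Membership.Propositional using (_∈_; _∉_)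
open import Data.List.Membership.Propositional.Properties using (∈-filter⁺; ∈-filter⁻; ∈-allFin)
open import Data.Product using (Σ; ∃; ∃-syntax; _×_; _,_; proj₁; proj₂)
open import Data.Product.Relation.Binary.Pointwise.NonDependent using (_×ₛ_; Pointwise-≡↔≡)
open import Data.Product.Function.NonDependent.Setoid using (_×-inverse_)
open import Data.Sum as Sum using (_⊎_; inj₁; inj₂)
open import Data.Empty using (⊥; ⊥-elim)
open import Function.Base using (_∘_; id)
open import Function.Bundles using (Inverse; _↔_; _⇔_; mk⇔; Equivalence; mk↔ₛ′; mk⤖)
open import Function.Definitions using (Bijective)
open import Function.Properties.Bijection using (⤖⇒↔)
open import Function.Properties.Inverse using (↔-sym)
open import Function.Consequences.Propositional using (inverseᵇ⇒bijective)
import Function.Construct.Composition as Compose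
open import Function.Construct.Identity using (↔-id)
open import Relation.Nullary using (¬_; Dec; yes; no)
open import Relation.Nullary.Decidable using (map′; ¬?; _×-dec_; _→-dec_; from-yes)
open import Relation.Binary.Bundles using (Setoid)
open import Relation.Binary.Definitions using (DecidableEquality; Symmetric; tri<; tri≈; tri>)
open import Relation.Binary.PropositionalEquality as ≡
  using (_≡_; _≢_; refl; sym; trans; cong; cong₂; subst; subst₂; module ≡-Reasoning)
open import Algebra.Bundles using (Group; CommutativeSemigroup)
open import Algebra.Structures using (IsGroup)
import Algebra.Properties.Group as GroupProperties
import Algebra.Properties.CommutativeSemigroup as CommutativeSemigroupProperties

-- Counting free actions of the Klein four-group

module ListDeletion {A : Set} (_≟_ : DecidableEquality A) where

  delete : A → List A → List A
  delete x = filter (λ y → ¬? (y ≟ x))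

  ∈-delete⁺ : ∀ {x y xs} → y ∈ xs → y ≢ x → y ∈ delete x xs
  ∈-delete⁺ = ∈-filter⁺ _

  ∈-delete⁻ : ∀ {x y xs} → y ∈ delete x xs → y ∈ xs × y ≢ x
  ∈-delete⁻ = ∈-filter⁻ _

  length-delete : ∀ {x xs} → Unique xs → x ∈ xs → length xs ≡ suc (length (delete x xs))
  length-delete {x} {y ∷ ys} (y∉ys ∷ _) x∈ with y ≟ x
  ... | yes refl = cong (suc ∘ length) (sym (filter-all _ (All.map (λ y≢z z≡y → y≢z (sym z≡y)) y∉ys)))
  length-delete {x} {y ∷ ys} _          (here x≡y) | no y≢x = ⊥-elim (y≢x (sym x≡y))
  length-delete {x} {y ∷ ys} (_ ∷ u)    (there x∈) | no _   = cong suc (length-delete u x∈)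

  deleteAll : List A → List A → List A
  deleteAll []       xs = xs
  deleteAll (o ∷ os) xs = deleteAll os (delete o xs)

  ∈-deleteAll⁺ : ∀ {y} os {xs} → y ∈ xs → y ∉ os → y ∈ deleteAll os xs
  ∈-deleteAll⁺ []       y∈ _  = y∈
  ∈-deleteAll⁺ (o ∷ os) y∈ y∉ = ∈-deleteAll⁺ os (∈-delete⁺ y∈ (y∉ ∘ here)) (y∉ ∘ there)

  ∈-deleteAll⁻ : ∀ {y} os {xs} → y ∈ deleteAll os xs → y ∈ xs × y ∉ os
  ∈-deleteAll⁻ []       y∈ = y∈ , λ ()
  ∈-deleteAll⁻ (o ∷ os) y∈ with ∈-deleteAll⁻ os y∈
  ... | y∈′ , y∉os with ∈-delete⁻ y∈′
  ...   | y∈xs , y≢o = y∈xs , λ { (here y≡o) → y≢o y≡o ; (there y∈os) → y∉os y∈os }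

  deleteAll⁺ : ∀ os {xs} → Unique xs → Unique (deleteAll os xs)
  deleteAll⁺ []       u = u
  deleteAll⁺ (o ∷ os) u = deleteAll⁺ os (filter⁺ _ u)

  length-deleteAll : ∀ {os xs} → Unique os → All (_∈ xs) os → Unique xs →
                     length xs ≡ length os + length (deleteAll os xs)
  length-deleteAll {[]}     _          _          _   = refl
  length-deleteAll {o ∷ os} {xs} (o∉os ∷ u) (o∈ ∷ os⊆) uxs =
    trans (length-delete uxs o∈) (cong suc (length-deleteAll u os⊆delete (filter⁺ _ uxs)))
    where
    os⊆delete : All (_∈ delete o xs) os
    os⊆delete = All.zipWith (λ (o≢z , z∈) → ∈-delete⁺ z∈ (o≢z ∘ sym)) (o∉os , os⊆)

module FreeKleinAction {A : Set} (_≟_ : DecidableEquality A) (s t : A → A)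
  (s-involutive : ∀ x → s (s x) ≡ x) (t-involutive : ∀ x → t (t x) ≡ x)
  (s∘t≡t∘s : ∀ x → s (t x) ≡ t (s x))
  (s-fixedPointFree : ∀ x → s x ≢ x) (t-fixedPointFree : ∀ x → t x ≢ x)
  (s∘t-fixedPointFree : ∀ x → s (t x) ≢ x) where

  open ListDeletion _≟_

  orbit : A → List A
  orbit x = x ∷ s x ∷ t x ∷ s (t x) ∷ []

  s-injective : ∀ {x y} → s x ≡ s y → x ≡ y
  s-injective {x} {y} sx≡sy = trans (sym (s-involutive x)) (trans (cong s sx≡sy) (s-involutive y))

  orbit-unique : ∀ x → Unique (orbit x)
  orbit-unique x =
    (≢-sym (s-fixedPointFree x) ∷ ≢-sym (t-fixedPointFree x) ∷ ≢-sym (s∘t-fixedPointFree x) ∷ []) ∷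
    ((λ sx≡tx → s∘t-fixedPointFree x (trans (cong s (sym sx≡tx)) (s-involutive x))) ∷
     (λ sx≡stx → t-fixedPointFree x (sym (s-injective sx≡stx))) ∷ []) ∷
    (≢-sym (s-fixedPointFree (t x)) ∷ []) ∷ [] ∷ []
    where
    ≢-sym : ∀ {y z} → y ≢ z → z ≢ y
    ≢-sym y≢z = y≢z ∘ sym

  s-orbit : ∀ {x y} → y ∈ orbit x → s y ∈ orbit x
  s-orbit (here refl)                         = there (here refl)
  s-orbit (there (here refl))                 = here (s-involutive _)
  s-orbit (there (there (here refl)))         = there (there (there (here refl)))
  s-orbit (there (there (there (here refl)))) = there (there (here (s-involutive _)))

  t-orbit : ∀ {x y} → y ∈ orbit x → t y ∈ orbit x
  t-orbit     (here refl)                         = there (there (here refl))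
  t-orbit     (there (here refl))                 = there (there (there (here (sym (s∘t≡t∘s _)))))
  t-orbit     (there (there (here refl)))         = here (t-involutive _)
  t-orbit {x} (there (there (there (here refl)))) = there (here (trans (cong t (s∘t≡t∘s x)) (t-involutive (s x))))

  Closed : List A → Set
  Closed xs = ∀ {y} → y ∈ xs → s y ∈ xs × t y ∈ xs

  closed-deleteAll-orbit : ∀ {x xs} → Closed xs → Closed (deleteAll (orbit x) xs)
  closed-deleteAll-orbit {x} closed y∈ with ∈-deleteAll⁻ (orbit x) y∈
  ... | y∈xs , y∉orbit =
    ∈-deleteAll⁺ (orbit x) (proj₁ (closed y∈xs)) (y∉orbit ∘ subst (_∈ orbit x) (s-involutive _) ∘ s-orbit) ,
    ∈-deleteAll⁺ (orbit x) (proj₂ (closed y∈xs)) (y∉orbit ∘ subst (_∈ orbit x) (t-involutive _) ∘ t-orbit)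

  4∣length : ∀ xs → Unique xs → Closed xs → 4 ∣ length xs
  4∣length xs = <-rec Claim step (length xs) xs refl
    where
    Claim : ℕ → Set
    Claim m = ∀ xs → length xs ≡ m → Unique xs → Closed xs → 4 ∣ m

    step : ∀ m → (∀ {m′} → m′ < m → Claim m′) → Claim m
    step _ _   []       refl _ _      = 4 ∣0
    step _ rec (x ∷ ys) refl u closed = subst (4 ∣_) (sym length≡)
      (∣m∣n⇒∣m+n ∣-refl (rec shorter rest refl (deleteAll⁺ (orbit x) u) (closed-deleteAll-orbit closed)))
      where
      rest = deleteAll (orbit x) (x ∷ ys)
      tx∈ = proj₂ (closed (here refl))
      length≡ : length (x ∷ ys) ≡ 4 + length rest
      length≡ = length-deleteAll (orbit-unique x)
                  (here refl ∷ proj₁ (closed (here refl)) ∷ tx∈ ∷ proj₁ (closed tx∈) ∷ []) u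
      shorter : length rest < length (x ∷ ys)
      shorter = subst (length rest <_) (sym length≡) (m<n+m (length rest) (s≤s z≤n))

module _ {S : Setoid 0ℓ 0ℓ} {k : ℕ} (card : HasCard S k) where
  open Setoid S using (Carrier; _≈_) renaming (refl to ≈-refl; sym to ≈-sym)
  open Inverse card

  private
    conj : (Carrier → Carrier) → Fin k → Fin k
    conj f i = to (f (from i))

    conj-∘ : ∀ {f} g → (∀ {x y} → x ≈ y → f x ≈ f y) → ∀ i → conj f (conj g i) ≡ conj (f ∘ g) i
    conj-∘ g f-cong i = to-cong (f-cong (inverseʳ refl))

    conj-cong : ∀ {f g} → (∀ x → f x ≈ g x) → ∀ i → conj f i ≡ conj g i
    conj-cong f≈g i = to-cong (f≈g (from i))

    conj-id : ∀ {f} → (∀ x → f x ≈ x) → ∀ i → conj f i ≡ i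
    conj-id f≈id i = trans (conj-cong f≈id i) (inverseˡ ≈-refl)

    conj-fixedPointFree : ∀ {f} → (∀ x → ¬ f x ≈ x) → ∀ i → conj f i ≢ i
    conj-fixedPointFree f-fpf i fi≡i = f-fpf (from i) (≈-sym (inverseʳ (sym fi≡i)))

  4∣card : (s t : Carrier → Carrier) →
           (∀ {x y} → x ≈ y → s x ≈ s y) → (∀ {x y} → x ≈ y → t x ≈ t y) →
           (∀ x → s (s x) ≈ x) → (∀ x → t (t x) ≈ x) → (∀ x → s (t x) ≈ t (s x)) →
           (∀ x → ¬ s x ≈ x) → (∀ x → ¬ t x ≈ x) → (∀ x → ¬ s (t x) ≈ x) → 4 ∣ k
  4∣card s t s-cong t-cong s-inv t-inv st≈ts s-fpf t-fpf st-fpf =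
    subst (4 ∣_) (length-tabulate id) (FreeKleinAction.4∣length _≟_ (conj s) (conj t)
      (λ i → trans (conj-∘ s s-cong i) (conj-id s-inv i))
      (λ i → trans (conj-∘ t t-cong i) (conj-id t-inv i))
      (λ i → trans (conj-∘ t s-cong i) (trans (conj-cong st≈ts i) (sym (conj-∘ s t-cong i))))
      (conj-fixedPointFree s-fpf) (conj-fixedPointFree t-fpf)
      (λ i sti≡i → conj-fixedPointFree st-fpf i (trans (sym (conj-∘ t s-cong i)) sti≡i))
      (allFin k) (allFin⁺ k) (λ _ → ∈-allFin _ , ∈-allFin _))

-- Automorphisms of a relation

module _ {A : Set} (R : A → A → Set) where

  IsAutomorphism : (A → A) → Set
  IsAutomorphism f = Bijective _≡_ _≡_ f × (∀ x y → R x y ⇔ R (f x) (f y))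

  AutomorphismSetoid : Setoid 0ℓ 0ℓ
  AutomorphismSetoid = record
    { Carrier       = Σ (A → A) IsAutomorphism
    ; _≈_           = λ f g → ∀ x → proj₁ f x ≡ proj₁ g x
    ; isEquivalence = record
      { refl  = λ x → refl
      ; sym   = λ f≈g x → sym (f≈g x)
      ; trans = λ f≈g g≈h x → trans (f≈g x) (g≈h x) } }

  ∘-isAutomorphism : ∀ {f g} → IsAutomorphism f → IsAutomorphism g → IsAutomorphism (g ∘ f)
  ∘-isAutomorphism {f} (f-bijective , f-preserves) (g-bijective , g-preserves) =
    Compose.bijective _≡_ _≡_ _≡_ f-bijective g-bijective ,
    λ x y → g-preserves (f x) (f y) Compose.⇔-∘ f-preserves x y

  involution-isAutomorphism : ∀ {f} → (∀ x → f (f x) ≡ x) →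
                              (∀ {x y} → R x y → R (f x) (f y)) → IsAutomorphism f
  involution-isAutomorphism {f} f∘f≡id preserves =
    ((λ {x} {y} fx≡fy → trans (sym (f∘f≡id x)) (trans (cong f fx≡fy) (f∘f≡id y))) ,
     (λ y → f y , λ z≡fy → trans (cong f z≡fy) (f∘f≡id y))) ,
    λ x y → mk⇔ preserves (subst₂ R (f∘f≡id x) (f∘f≡id y) ∘ preserves)

  Twins : A → A → Set
  Twins a b = ∀ c → c ≢ a → c ≢ b → R a c ⇔ R b c

module _ {n : ℕ} (a b : Fin n) where

  transpose-matchˡ : transpose a b a ≡ b
  transpose-matchˡ with a ≟ a
  ... | yes _   = refl
  ... | no a≢a = ⊥-elim (a≢a refl)

  transpose-matchʳ : transpose a b b ≡ a
  transpose-matchʳ with b ≟ a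
  ... | yes refl = refl
  ... | no _ with b ≟ b
  ...   | yes _   = refl
  ...   | no b≢b = ⊥-elim (b≢b refl)

  transpose-mismatch : ∀ {x} → x ≢ a → x ≢ b → transpose a b x ≡ x
  transpose-mismatch {x} x≢a x≢b with x ≟ a
  ... | yes x≡a = ⊥-elim (x≢a x≡a)
  ... | no _ with x ≟ b
  ...   | yes x≡b = ⊥-elim (x≢b x≡b)
  ...   | no _    = refl

  data TransposeView : Fin n → Set where
    left  : TransposeView a
    right : TransposeView b
    other : ∀ {x} → x ≢ a → x ≢ b → TransposeView x

  transposeView : ∀ x → TransposeView x
  transposeView x with x ≟ a | x ≟ b
  ... | yes refl | _        = left
  ... | no _     | yes refl = right
  ... | no x≢a   | no x≢b   = other x≢a x≢b

  transpose-involutive : ∀ x → transpose a b (transpose a b x) ≡ x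
  transpose-involutive x with transposeView x
  ... | left          rewrite transpose-matchˡ = transpose-matchʳ
  ... | right         rewrite transpose-matchʳ = transpose-matchˡ
  ... | other x≢a x≢b rewrite transpose-mismatch x≢a x≢b = transpose-mismatch x≢a x≢b

transpose-comm : ∀ {n} {a b c d : Fin n} → a ≢ c → a ≢ d → b ≢ c → b ≢ d →
                 ∀ x → transpose a b (transpose c d x) ≡ transpose c d (transpose a b x)
transpose-comm {a = a} {b} {c} {d} a≢c a≢d b≢c b≢d x with transposeView a b x | transposeView c d x
... | left  | left  = ⊥-elim (a≢c refl)
... | left  | right = ⊥-elim (a≢d refl)
... | right | left  = ⊥-elim (b≢c refl)
... | right | right = ⊥-elim (b≢d refl)
... | left  | other _ _
  rewrite transpose-mismatch c d a≢c a≢d | transpose-matchˡ a b | transpose-mismatch c d b≢c b≢d = refl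
... | right | other _ _
  rewrite transpose-mismatch c d b≢c b≢d | transpose-matchʳ a b | transpose-mismatch c d a≢c a≢d = refl
... | other _ _ | left
  rewrite transpose-mismatch a b (a≢c ∘ sym) (b≢c ∘ sym) | transpose-matchˡ c d
        | transpose-mismatch a b (a≢d ∘ sym) (b≢d ∘ sym) = refl
... | other _ _ | right
  rewrite transpose-mismatch a b (a≢d ∘ sym) (b≢d ∘ sym) | transpose-matchʳ c d
        | transpose-mismatch a b (a≢c ∘ sym) (b≢c ∘ sym) = refl
... | other x≢a x≢b | other x≢c x≢d
  rewrite transpose-mismatch c d x≢c x≢d | transpose-mismatch a b x≢a x≢b | transpose-mismatch c d x≢c x≢d = refl

module _ {n : ℕ} {R : Fin n → Fin n → Set} (R-sym : Symmetric R) (R-irrefl : ∀ x → ¬ R x x) where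

  transpose-isAutomorphism : ∀ {a b} → Twins R a b → IsAutomorphism R (transpose a b)
  transpose-isAutomorphism {a} {b} twins = involution-isAutomorphism R (transpose-involutive a b) preserves
    where
    preserves : ∀ {x y} → R x y → R (transpose a b x) (transpose a b y)
    preserves {x} {y} r with transposeView a b x | transposeView a b y
    ... | left  | left  = ⊥-elim (R-irrefl a r)
    ... | right | right = ⊥-elim (R-irrefl b r)
    ... | left  | right rewrite transpose-matchˡ a b | transpose-matchʳ a b = R-sym r
    ... | right | left  rewrite transpose-matchˡ a b | transpose-matchʳ a b = R-sym r
    ... | left  | other y≢a y≢b rewrite transpose-matchˡ a b | transpose-mismatch a b y≢a y≢b =
      Equivalence.to (twins y y≢a y≢b) r
    ... | right | other y≢a y≢b rewrite transpose-matchʳ a b | transpose-mismatch a b y≢a y≢b =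
      Equivalence.from (twins y y≢a y≢b) r
    ... | other x≢a x≢b | left  rewrite transpose-matchˡ a b | transpose-mismatch a b x≢a x≢b =
      R-sym (Equivalence.to (twins x x≢a x≢b) (R-sym r))
    ... | other x≢a x≢b | right rewrite transpose-matchʳ a b | transpose-mismatch a b x≢a x≢b =
      R-sym (Equivalence.from (twins x x≢a x≢b) (R-sym r))
    ... | other x≢a x≢b | other y≢a y≢b
      rewrite transpose-mismatch a b x≢a x≢b | transpose-mismatch a b y≢a y≢b = r

  disjointTwins⇒4∣card : ∀ {a b c d k} → Unique (a ∷ b ∷ c ∷ d ∷ []) → Twins R a b → Twins R c d →
                         HasCard (AutomorphismSetoid R) k → 4 ∣ k
  disjointTwins⇒4∣card {a} {b} {c} {d} ((a≢b ∷ a≢c ∷ a≢d ∷ []) ∷ (b≢c ∷ b≢d ∷ []) ∷ (c≢d ∷ []) ∷ [] ∷ [])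
                       ab-twins cd-twins card =
    4∣card card (σ ∙_) (τ ∙_)
      (λ ρ≈ρ′ x → cong (transpose a b) (ρ≈ρ′ x)) (λ ρ≈ρ′ x → cong (transpose c d) (ρ≈ρ′ x))
      (λ ρ x → transpose-involutive a b (proj₁ ρ x)) (λ ρ x → transpose-involutive c d (proj₁ ρ x))
      (λ ρ x → transpose-comm a≢c a≢d b≢c b≢d (proj₁ ρ x))
      (moves σ a λ σa≡a → a≢b (trans (sym σa≡a) (transpose-matchˡ a b)))
      (moves τ c λ τc≡c → c≢d (trans (sym τc≡c) (transpose-matchˡ c d)))
      (moves (σ ∙ τ) a λ στa≡a → a≢b (trans (sym στa≡a)
        (trans (cong (transpose a b) (transpose-mismatch c d a≢c a≢d)) (transpose-matchˡ a b))))
    where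
    Aut = Setoid.Carrier (AutomorphismSetoid R)
    open Setoid (AutomorphismSetoid R) using (_≈_)

    _∙_ : Aut → Aut → Aut
    (f , f-aut) ∙ (g , g-aut) = f ∘ g , ∘-isAutomorphism R g-aut f-aut

    σ τ : Aut
    σ = transpose a b , transpose-isAutomorphism ab-twins
    τ = transpose c d , transpose-isAutomorphism cd-twins

    moves : ∀ (f : Aut) p → proj₁ f p ≢ p → ∀ ρ → ¬ (f ∙ ρ) ≈ ρ
    moves f p fp≢p (ρ , (_ , ρ-surjective) , _) fρ≈ρ with ρ-surjective p
    ... | x , ρx≡p = fp≢p (trans (cong (proj₁ f) (sym (ρx≡p refl))) (trans (fρ≈ρ x) (ρx≡p refl)))

-- Counting automorphisms

module _ {A B : Set} {R : A → A → Set} {S : B → B → Set} (θ : A ↔ B)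
         (θ-preserves : ∀ x y → R x y ⇔ S (Inverse.to θ x) (Inverse.to θ y)) where
  open Inverse θ

  ↔-reflects : ∀ x y → S x y ⇔ R (from x) (from y)
  ↔-reflects x y = mk⇔
    (Equivalence.from (θ-preserves (from x) (from y)) ∘ subst₂ S (sym (strictlyInverseˡ x)) (sym (strictlyInverseˡ y)))
    (subst₂ S (strictlyInverseˡ x) (strictlyInverseˡ y) ∘ Equivalence.to (θ-preserves (from x) (from y)))

  conjugate-isAutomorphism : ∀ {f} → IsAutomorphism R f → IsAutomorphism S (to ∘ f ∘ from)
  conjugate-isAutomorphism {f} (f-bijective , f-preserves) =
    Compose.bijective _≡_ _≡_ _≡_
      (Compose.bijective _≡_ _≡_ _≡_ (inverseᵇ⇒bijective (Inverse.inverse (↔-sym θ))) f-bijective)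
      (inverseᵇ⇒bijective inverse) ,
    λ x y → θ-preserves (f (from x)) (f (from y))
              Compose.⇔-∘ (f-preserves (from x) (from y) Compose.⇔-∘ ↔-reflects x y)

automorphisms-transport : ∀ {A B : Set} {R : A → A → Set} {S : B → B → Set} (θ : A ↔ B) →
                          (∀ x y → R x y ⇔ S (Inverse.to θ x) (Inverse.to θ y)) →
                          Inverse (AutomorphismSetoid R) (AutomorphismSetoid S)
automorphisms-transport θ θ-preserves = record
  { to        = λ (f , f-aut) → to ∘ f ∘ from , conjugate-isAutomorphism θ θ-preserves f-aut
  ; from      = λ (g , g-aut) → from ∘ g ∘ to , conjugate-isAutomorphism (↔-sym θ) (↔-reflects θ θ-preserves) g-aut
  ; to-cong   = λ f≈g x → cong to (f≈g (from x))
  ; from-cong = λ f≈g x → cong from (f≈g (to x))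
  ; inverse   = (λ {(g , _)} f≈ x →
                   trans (cong to (f≈ (from x))) (trans (strictlyInverseˡ _) (cong g (strictlyInverseˡ x)))) ,
                (λ {(f , _)} g≈ x →
                   trans (cong from (g≈ (to x))) (trans (strictlyInverseʳ _) (cong f (strictlyInverseʳ x))))
  }
  where open Inverse θ

PermutationSetoid : Set → Setoid 0ℓ 0ℓ
PermutationSetoid A = record
  { Carrier       = A ↔ A
  ; _≈_           = λ π ρ → ∀ x → Inverse.to π x ≡ Inverse.to ρ x
  ; isEquivalence = record
    { refl  = λ x → refl
    ; sym   = λ π≈ρ x → sym (π≈ρ x)
    ; trans = λ π≈ρ ρ≈σ x → trans (π≈ρ x) (ρ≈σ x) } }

punchOut-cong₂ : ∀ {n} {i i′ j j′ : Fin (suc n)} {i≢j : i ≢ j} {i′≢j′ : i′ ≢ j′} →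
                 i ≡ i′ → j ≡ j′ → punchOut i≢j ≡ punchOut i′≢j′
punchOut-cong₂ {i = i} refl j≡j′ = punchOut-cong i j≡j′

remove-cong : ∀ {m} i {π ρ : Permutation′ (suc m)} → π Perm.≈ ρ → remove i π Perm.≈ remove i ρ
remove-cong i π≈ρ j = punchOut-cong₂ (π≈ρ i) (π≈ρ (punchIn i j))

insert-cong : ∀ {m} i {j j′} {π ρ : Permutation′ m} → j ≡ j′ → π Perm.≈ ρ → insert i j π Perm.≈ insert i j′ ρ
insert-cong i j≡j′ π≈ρ k with i ≟ k
... | yes _  = j≡j′
... | no i≢k = cong₂ punchIn j≡j′ (π≈ρ (punchOut i≢k))

permutation-decomposition : ∀ m → Inverse (PermutationSetoid (Fin (suc m)))
                                          (≡.setoid (Fin (suc m)) ×ₛ PermutationSetoid (Fin m))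
permutation-decomposition m = record
  { to        = λ π → π ⟨$⟩ʳ 0F , remove 0F π
  ; from      = λ (j , ρ) → insert 0F j ρ
  ; to-cong   = λ {π} {ρ} π≈ρ → π≈ρ 0F , remove-cong 0F {π} {ρ} π≈ρ
  ; from-cong = λ (j≡j′ , π≈ρ) → insert-cong 0F j≡j′ π≈ρ
  ; inverse   = (λ {(j , ρ)} {π} π≈ → π≈ 0F ,
                   λ k → trans (remove-cong 0F {π} {insert 0F j ρ} π≈ k) (remove-insert 0F j ρ k)) ,
                (λ {π} (j≡ , ρ≈) k → trans (insert-cong 0F j≡ ρ≈ k) (insert-remove 0F π k))
  }

|Permutation|≡! : ∀ m → HasCard (PermutationSetoid (Fin m)) (m !)
|Permutation|≡! zero = record
  { to        = λ _ → 0F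
  ; from      = λ _ → Perm.id
  ; to-cong   = λ _ → refl
  ; from-cong = λ _ ()
  ; inverse   = (λ { {0F} _ → refl }) , (λ _ ())
  }
|Permutation|≡! (suc m) =
  Compose.inverse (permutation-decomposition m)
    (Compose.inverse (↔-id (Fin (suc m)) ×-inverse |Permutation|≡! m)
      (Compose.inverse Pointwise-≡↔≡ (↔-sym *↔×)))

≢-automorphisms≅permutations : ∀ {A : Set} → Inverse (AutomorphismSetoid {A} _≢_) (PermutationSetoid A)
≢-automorphisms≅permutations = record
  { to        = λ (f , f-bijective , _) → ⤖⇒↔ (mk⤖ f-bijective)
  ; from      = λ π → let π-bijective = inverseᵇ⇒bijective (Inverse.inverse π) in
                      Inverse.to π , π-bijective ,
                      λ x y → mk⇔ (λ x≢y → x≢y ∘ proj₁ π-bijective) (λ πx≢πy → πx≢πy ∘ cong (Inverse.to π))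
  ; to-cong   = id
  ; from-cong = id
  ; inverse   = id , id
  }

Star : ∀ {A : Set} → A → A → A → Set
Star c x y = x ≢ y × (x ≡ c ⊎ y ≡ c)

Star-preserved : ∀ {A B : Set} {c : A} {c′ : B} {f : A → B} → (∀ {x y} → f x ≡ f y → x ≡ y) → f c ≡ c′ →
                 ∀ x y → Star c x y ⇔ Star c′ (f x) (f y)
Star-preserved {c = c} {c′} {f} f-injective fc≡c′ x y = mk⇔
  (λ (x≢y , centred) → x≢y ∘ f-injective , Sum.map (moves-centre x) (moves-centre y) centred)
  (λ (fx≢fy , centred) → fx≢fy ∘ cong f , Sum.map (reflects-centre x) (reflects-centre y) centred)
  where
  moves-centre : ∀ x → x ≡ c → f x ≡ c′
  moves-centre x refl = fc≡c′
  reflects-centre : ∀ x → f x ≡ c′ → x ≡ c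
  reflects-centre x fx≡c′ = f-injective (trans fx≡c′ (sym fc≡c′))

star-centre-fixed : ∀ {m} {f : Fin (suc (suc (suc m))) → Fin (suc (suc (suc m)))} →
                    IsAutomorphism (Star 0F) f → f 0F ≡ 0F
star-centre-fixed {f = f} ((f-injective , _) , f-preserves) with f 0F ≟ 0F
... | yes f0≡0 = f0≡0
... | no f0≢0  = ⊥-elim (1≢2 (f-injective (trans (leaf 1F (λ ())) (sym (leaf 2F (λ ()))))))
  where
  1≢2 : 1F ≢ 2F
  1≢2 ()
  leaf : ∀ j → j ≢ 0F → f j ≡ 0F
  leaf j j≢0 with Equivalence.to (f-preserves 0F j) (j≢0 ∘ sym , inj₁ refl)
  ... | _ , inj₁ f0≡0 = ⊥-elim (f0≢0 f0≡0)
  ... | _ , inj₂ fj≡0 = fj≡0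

star-automorphisms≅permutations : ∀ m → Inverse (AutomorphismSetoid (Star {Fin (suc (suc (suc m)))} 0F))
                                                (PermutationSetoid (Fin (suc (suc m))))
star-automorphisms≅permutations m = record
  { to        = λ (f , f-aut) → remove 0F (asPermutation f-aut)
  ; from      = λ π → let lift₀π-bijective = inverseᵇ⇒bijective (Inverse.inverse (lift₀ π)) in
                      lift₀ π ⟨$⟩ʳ_ , lift₀π-bijective , Star-preserved (proj₁ lift₀π-bijective) refl
  ; to-cong   = λ {(_ , f-aut)} {(_ , g-aut)} f≈g → remove-cong 0F {asPermutation f-aut} {asPermutation g-aut} f≈g
  ; from-cong = λ {π} {ρ} π≈ρ → lift₀-cong π ρ π≈ρ
  ; inverse   = (λ {π} {(_ , f-aut)} f≈ → remove-cong 0F {asPermutation f-aut} {lift₀ π} f≈) ,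
                (λ {(_ , f-aut)} {π} π≈ x →
                   trans (lift₀-cong π _ π≈ x) (lift₀-remove (asPermutation f-aut) (star-centre-fixed f-aut) x))
  }
  where
  asPermutation : ∀ {f} → IsAutomorphism (Star 0F) f → Permutation′ (suc (suc (suc m)))
  asPermutation (f-bijective , _) = ⤖⇒↔ (mk⤖ f-bijective)

squareFree-upTo : ∀ k → (∀ {d} → d < suc k → d * d ∣ k → d ≡ 1) → SquareFree k
squareFree-upTo zero    bounded d d²∣k with () ← bounded (s≤s z≤n) (0 ∣0)
squareFree-upTo (suc k) bounded d d²∣k = bounded (s≤s (≤-trans (d≤d² d) (∣⇒≤ d²∣k))) d²∣k
  where
  d≤d² : ∀ d → d ≤ d * d
  d≤d² zero    = z≤n
  d≤d² (suc d) = m≤m*n (suc d) (suc d)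

squareFree? : ∀ k → Dec (SquareFree k)
squareFree? k = map′ (squareFree-upTo k) (λ squareFree {d} _ → squareFree d)
                     (allUpTo? (λ d → d * d ∣? k →-dec d ℕ.≟ 1) (suc k))

-- The enhanced power graph

module EnhancedPowerGraph {n : ℕ} (G : FinGroup n) where
  open FinGroup G
  open IsGroup isGroup using (assoc; identityˡ; identityʳ; inverseʳ)

  private
    group : Group 0ℓ 0ℓ
    group = record { isGroup = isGroup }

  open GroupProperties group
    using (identityˡ-unique; identityʳ-unique; inverseʳ-unique; ⁻¹-involutive; ⁻¹-anti-homo-∙; \\-leftDividesʳ)

  infixl 30 _^_
  _^_ : Fin n → ℕ → Fin n
  _^_ = pow G

  _∈⟨_⟩ : Fin n → Fin n → Set
  _∈⟨_⟩ = InCyclic G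

  OrderAtLeast : Fin n → ℕ → Set
  OrderAtLeast z m = ∀ d → 0 < d → d < m → z ^ d ≢ ε

  Exponent2 : Set
  Exponent2 = ∀ z → z ∙ z ≡ ε

  ^-+ : ∀ z a b → z ^ (a + b) ≡ z ^ a ∙ z ^ b
  ^-+ z zero    b = sym (identityˡ _)
  ^-+ z (suc a) b = trans (cong (z ∙_) (^-+ z a b)) (sym (assoc _ _ _))

  ^-* : ∀ z a j → (z ^ a) ^ j ≡ z ^ (j * a)
  ^-* z a zero    = refl
  ^-* z a (suc j) = trans (cong (z ^ a ∙_) (^-* z a j)) (sym (^-+ z a (j * a)))

  ε^ : ∀ k → ε ^ k ≡ ε
  ε^ zero    = refl
  ε^ (suc k) = trans (cong (ε ∙_) (ε^ k)) (identityˡ ε)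

  ^-mod : ∀ {z m} .{{_ : NonZero m}} → z ^ m ≡ ε → ∀ k → z ^ toℕ (k mod m) ≡ z ^ k
  ^-mod {z} {m} z^m≡ε k = sym (begin
    z ^ k                                 ≡⟨ cong (z ^_) (DivMod.property (k divMod m)) ⟩
    z ^ (toℕ (k mod m) + k / m * m)       ≡⟨ ^-+ z (toℕ (k mod m)) (k / m * m) ⟩
    z ^ toℕ (k mod m) ∙ z ^ (k / m * m)   ≡⟨ cong (z ^ toℕ (k mod m) ∙_) z^[qm]≡ε ⟩
    z ^ toℕ (k mod m) ∙ ε                 ≡⟨ identityʳ _ ⟩
    z ^ toℕ (k mod m)                     ∎)
    where
    open ≡-Reasoning
    z^[qm]≡ε : z ^ (k / m * m) ≡ ε
    z^[qm]≡ε = begin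
      z ^ (k / m * m)   ≡⟨ ^-* z m (k / m) ⟨
      (z ^ m) ^ (k / m) ≡⟨ cong (_^ (k / m)) z^m≡ε ⟩
      ε ^ (k / m)       ≡⟨ ε^ (k / m) ⟩
      ε                 ∎

  finiteOrder : ∀ z → ∃[ m ] (z ^ suc m ≡ ε)
  finiteOrder z with pigeonhole (n<1+n n) (λ (i : Fin (suc n)) → z ^ toℕ i)
  ... | i , j , i<j , z^i≡z^j with m≤n⇒∃[o]m+o≡n i<j
  ... | d , i+1+d≡j = d , identityʳ-unique (z ^ toℕ i) _ (begin
    z ^ toℕ i ∙ z ^ suc d      ≡⟨ ^-+ z (toℕ i) (suc d) ⟨
    z ^ (toℕ i + suc d)        ≡⟨ cong (z ^_) (trans (+-suc (toℕ i) d) i+1+d≡j) ⟩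
    z ^ toℕ j                  ≡⟨ z^i≡z^j ⟨
    z ^ toℕ i                  ∎)
    where open ≡-Reasoning

  ε∈⟨⟩ : ∀ {z} → ε ∈⟨ z ⟩
  ε∈⟨⟩ = 0 , refl

  ∈⟨self⟩ : ∀ {z} → z ∈⟨ z ⟩
  ∈⟨self⟩ {z} = 1 , identityʳ z

  ∙-∈⟨⟩ : ∀ {x y z} → x ∈⟨ z ⟩ → y ∈⟨ z ⟩ → (x ∙ y) ∈⟨ z ⟩
  ∙-∈⟨⟩ {z = z} (i , refl) (j , refl) = i + j , ^-+ z i j

  ⁻¹-∈⟨⟩ : ∀ {x z} → x ∈⟨ z ⟩ → (x ⁻¹) ∈⟨ z ⟩
  ⁻¹-∈⟨⟩ {z = z} (a , refl) with finiteOrder (z ^ a)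
  ... | m , [z^a]^[1+m]≡ε = m * a , trans (sym (^-* z a m)) (inverseʳ-unique (z ^ a) ((z ^ a) ^ m) [z^a]^[1+m]≡ε)

  ∈⟨⟩? : ∀ x z → Dec (x ∈⟨ z ⟩)
  ∈⟨⟩? x z with finiteOrder z
  ... | m , z^[1+m]≡ε = map′ (λ (i , z^i≡x) → toℕ i , z^i≡x)
                             (λ (k , z^k≡x) → k mod suc m , trans (^-mod z^[1+m]≡ε k) z^k≡x)
                             (any? λ i → z ^ toℕ i ≟ x)

  Adj-sym : ∀ {x y} → Adj G x y → Adj G y x
  Adj-sym (x≢y , z , x∈ , y∈) = x≢y ∘ sym , z , y∈ , x∈

  Adj-irrefl : ∀ x → ¬ Adj G x x
  Adj-irrefl x (x≢x , _) = x≢x refl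

  ε-Adj : ∀ {x} → x ≢ ε → Adj G ε x
  ε-Adj x≢ε = x≢ε ∘ sym , _ , ε∈⟨⟩ , ∈⟨self⟩

  ⁻¹-twins : ∀ x → Twins (Adj G) x (x ⁻¹)
  ⁻¹-twins x c c≢x c≢x⁻¹ = mk⇔
    (λ (_ , z , x∈ , c∈) → c≢x⁻¹ ∘ sym , z , ⁻¹-∈⟨⟩ x∈ , c∈)
    (λ (_ , z , x⁻¹∈ , c∈) → c≢x ∘ sym , z , subst (_∈⟨ z ⟩) (⁻¹-involutive x) (⁻¹-∈⟨⟩ x⁻¹∈) , c∈)

  Pendant : Fin n → Set
  Pendant y = ∀ c → Adj G y c → c ≡ ε

  ^-involution : ∀ {z} → z ∙ z ≡ ε → ∀ k → z ^ k ≡ ε ⊎ z ^ k ≡ z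
  ^-involution z²≡ε zero = inj₁ refl
  ^-involution {z} z²≡ε (suc k) with ^-involution z²≡ε k
  ... | inj₁ z^k≡ε = inj₂ (trans (cong (z ∙_) z^k≡ε) (identityʳ z))
  ... | inj₂ z^k≡z = inj₁ (trans (cong (z ∙_) z^k≡z) z²≡ε)

  module _ (H : Fin n → Set) (ε∈H : H ε) (∙-closed : ∀ {x y} → H x → H y → H (x ∙ y))
           (outside-involution : ∀ {z} → ¬ H z → z ∙ z ≡ ε) where

    ^-closed : ∀ {z} → H z → ∀ k → H (z ^ k)
    ^-closed z∈H zero    = ε∈H
    ^-closed z∈H (suc k) = ∙-closed z∈H (^-closed z∈H k)

    outside⇒pendant : ∀ {y} → ¬ H y → Pendant y
    outside⇒pendant y∉H c (y≢c , z , (i , z^i≡y) , (j , z^j≡c))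
      with z∉H ← (λ z∈H → y∉H (subst H z^i≡y (^-closed z∈H i)))
      with ^-involution (outside-involution z∉H) i | ^-involution (outside-involution z∉H) j
    ... | inj₁ z^i≡ε | _          = ⊥-elim (y∉H (subst H (trans (sym z^i≡ε) z^i≡y) ε∈H))
    ... | inj₂ _     | inj₁ z^j≡ε = trans (sym z^j≡c) z^j≡ε
    ... | inj₂ z^i≡z | inj₂ z^j≡z = ⊥-elim (y≢c (trans (sym z^i≡y) (trans z^i≡z (trans (sym z^j≡z) z^j≡c))))

  pendant-twins : ∀ {a b} → a ≢ ε → b ≢ ε → Pendant a → Pendant b → Twins (Adj G) a b
  pendant-twins a≢ε b≢ε a-pendant b-pendant c _ _ = mk⇔
    (λ a~c → subst (Adj G _) (sym (a-pendant c a~c)) (Adj-sym (ε-Adj b≢ε)))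
    (λ b~c → subst (Adj G _) (sym (b-pendant c b~c)) (Adj-sym (ε-Adj a≢ε)))

  Cyclic : Set
  Cyclic = ∃[ g ] ∀ x → x ∈⟨ g ⟩

  cyclic⇒Adj⇔≢ : Cyclic → ∀ x y → Adj G x y ⇔ x ≢ y
  cyclic⇒Adj⇔≢ (g , generates) x y = mk⇔ proj₁ (λ x≢y → x≢y , g , generates x , generates y)

  cyclic⇒twins : Cyclic → ∀ a b → Twins (Adj G) a b
  cyclic⇒twins cyclic a b c c≢a c≢b = mk⇔
    (λ _ → Equivalence.from (cyclic⇒Adj⇔≢ cyclic b c) (c≢b ∘ sym))
    (λ _ → Equivalence.from (cyclic⇒Adj⇔≢ cyclic a c) (c≢a ∘ sym))

  module _ (exponent2 : Exponent2) where

    exponent2⇒pendant : ∀ {y} → y ≢ ε → Pendant y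
    exponent2⇒pendant = outside⇒pendant (_≡ ε) refl (λ { refl refl → identityˡ ε }) (λ {z} _ → exponent2 z)

    exponent2⇒Adj⇔Star : ∀ x y → Adj G x y ⇔ Star ε x y
    exponent2⇒Adj⇔Star x y = mk⇔ to from
      where
      to : Adj G x y → Star ε x y
      to x~y@(x≢y , _) with x ≟ ε
      ... | yes x≡ε = x≢y , inj₁ x≡ε
      ... | no x≢ε  = x≢y , inj₂ (exponent2⇒pendant x≢ε y x~y)
      from : Star ε x y → Adj G x y
      from (x≢y , inj₁ refl) = ε-Adj (x≢y ∘ sym)
      from (x≢y , inj₂ refl) = Adj-sym (ε-Adj x≢y)

  ^-distinct : ∀ {z m} → OrderAtLeast z m → ∀ {i j} → i < j → j < m → z ^ i ≢ z ^ j
  ^-distinct {z} order {i} i<j j<m z^i≡z^j with m≤n⇒∃[o]m+o≡n i<j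
  ... | o , refl = order (suc o) (s≤s z≤n) (≤-<-trans (s≤s (m≤n+m o i)) j<m)
                     (identityʳ-unique (z ^ i) (z ^ suc o)
                       (trans (sym (^-+ z i (suc o))) (trans (cong (z ^_) (+-suc i o)) (sym z^i≡z^j))))

  ^-injective : ∀ {z m} → OrderAtLeast z m →
                ∀ {i j} → i < m → j < m → z ^ i ≡ z ^ j → i ≡ j
  ^-injective order {i} {j} i<m j<m z^i≡z^j with <-cmp i j
  ... | tri< i<j _ _ = ⊥-elim (^-distinct order i<j j<m z^i≡z^j)
  ... | tri≈ _ i≡j _ = i≡j
  ... | tri> _ _ j<i = ⊥-elim (^-distinct order j<i i<m (sym z^i≡z^j))

  bijectiveHom⇒IsoTo : ∀ {A : Set} {_·_ : A → A → A} (h : A → Fin n) → (∀ {a b} → h a ≡ h b → a ≡ b) →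
                       (∀ x → ∃[ a ] (h a ≡ x)) → (∀ a b → h (a · b) ≡ h a ∙ h b) → IsoTo G A _·_
  bijectiveHom⇒IsoTo {_·_ = _·_} h h-injective h-surjective h-hom =
    mk↔ₛ′ h⁻¹ h (λ a → h-injective (proj₂ (h-surjective (h a)))) (λ x → proj₂ (h-surjective x)) ,
    λ x y → h-injective (begin
      h (h⁻¹ (x ∙ y))             ≡⟨ proj₂ (h-surjective (x ∙ y)) ⟩
      x ∙ y                       ≡⟨ cong₂ _∙_ (proj₂ (h-surjective x)) (proj₂ (h-surjective y)) ⟨
      h (h⁻¹ x) ∙ h (h⁻¹ y)       ≡⟨ h-hom (h⁻¹ x) (h⁻¹ y) ⟨
      h (h⁻¹ x · h⁻¹ y)           ∎)
    where
    open ≡-Reasoning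
    h⁻¹ : Fin n → _
    h⁻¹ x = proj₁ (h-surjective x)

  cyclic≅C : ∀ {g} m .{{_ : NonZero m}} → (∀ x → x ∈⟨ g ⟩) → g ^ m ≡ ε → OrderAtLeast g m →
             IsoTo G (Fin m) (addC m)
  cyclic≅C {g} m generates g^m≡ε order = bijectiveHom⇒IsoTo {_·_ = addC m} (λ i → g ^ toℕ i)
    (λ g^i≡g^j → toℕ-injective (^-injective order (toℕ<n _) (toℕ<n _) g^i≡g^j))
    (λ x → let k , g^k≡x = generates x in k mod m , trans (^-mod g^m≡ε k) g^k≡x)
    (λ i j → trans (^-mod g^m≡ε (toℕ i + toℕ j)) (^-+ g (toℕ i) (toℕ j)))

  ^-unique : ∀ {z m} → OrderAtLeast z m → Unique (tabulate {n = m} λ i → z ^ toℕ i)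
  ^-unique order = tabulate⁺ λ {i} {j} z^i≡z^j → toℕ-injective (^-injective order (toℕ<n i) (toℕ<n j) z^i≡z^j)

  ^2≡ε : ∀ {z} → z ∙ z ≡ ε → z ^ 2 ≡ ε
  ^2≡ε {z} z²≡ε = trans (cong (z ∙_) (identityʳ z)) z²≡ε

  exponent2⇒self-inverse : Exponent2 → ∀ z → z ≡ z ⁻¹
  exponent2⇒self-inverse exponent2 z = inverseʳ-unique z z (exponent2 z)

  exponent2⇒comm : Exponent2 → ∀ x y → x ∙ y ≡ y ∙ x
  exponent2⇒comm exponent2 x y = begin
    x ∙ y               ≡⟨ exponent2⇒self-inverse exponent2 (x ∙ y) ⟩
    (x ∙ y) ⁻¹          ≡⟨ ⁻¹-anti-homo-∙ x y ⟩
    (y ⁻¹) ∙ (x ⁻¹)     ≡⟨ cong₂ _∙_ (exponent2⇒self-inverse exponent2 y) (exponent2⇒self-inverse exponent2 x) ⟨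
    y ∙ x               ∎
    where open ≡-Reasoning

  exponent2≅V₄ : Exponent2 → ∀ {a b} → a ≢ ε → b ≢ ε → b ≢ a →
                 (∀ x → x ≡ ε ⊎ x ≡ a ⊎ x ≡ b ⊎ x ≡ a ∙ b) → IsoTo G (Fin 2 × Fin 2) kleinOp
  exponent2≅V₄ exponent2 {a} {b} a≢ε b≢ε b≢a covered = bijectiveHom⇒IsoTo {_·_ = kleinOp} h injective surjective hom
    where
    open ≡-Reasoning
    commutativeSemigroup : CommutativeSemigroup 0ℓ 0ℓ
    commutativeSemigroup = record { isCommutativeSemigroup = record
      { isSemigroup = IsGroup.isSemigroup isGroup ; comm = exponent2⇒comm exponent2 } }
    open CommutativeSemigroupProperties commutativeSemigroup using (interchange)

    h : Fin 2 × Fin 2 → Fin n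
    h (i , j) = a ^ toℕ i ∙ b ^ toℕ j

    h-10 : h (1F , 0F) ≡ a
    h-10 = trans (identityʳ _) (identityʳ a)
    h-01 : h (0F , 1F) ≡ b
    h-01 = trans (identityˡ _) (identityʳ b)
    h-11 : h (1F , 1F) ≡ a ∙ b
    h-11 = cong₂ _∙_ (identityʳ a) (identityʳ b)

    hom : ∀ p q → h (kleinOp p q) ≡ h p ∙ h q
    hom (i , j) (k , l) = begin
      h (kleinOp (i , j) (k , l))                         ≡⟨ cong₂ _∙_ (^-mod (^2≡ε (exponent2 a)) (toℕ i + toℕ k))
                                                                       (^-mod (^2≡ε (exponent2 b)) (toℕ j + toℕ l)) ⟩
      a ^ (toℕ i + toℕ k) ∙ b ^ (toℕ j + toℕ l)           ≡⟨ cong₂ _∙_ (^-+ a (toℕ i) (toℕ k)) (^-+ b (toℕ j) (toℕ l)) ⟩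
      (a ^ toℕ i ∙ a ^ toℕ k) ∙ (b ^ toℕ j ∙ b ^ toℕ l)   ≡⟨ interchange _ _ _ _ ⟩
      h (i , j) ∙ h (k , l)                               ∎

    kernel : ∀ p → h p ≡ ε → p ≡ (0F , 0F)
    kernel (0F , 0F) _     = refl
    kernel (1F , 0F) hp≡ε = ⊥-elim (a≢ε (trans (sym h-10) hp≡ε))
    kernel (0F , 1F) hp≡ε = ⊥-elim (b≢ε (trans (sym h-01) hp≡ε))
    kernel (1F , 1F) hp≡ε = ⊥-elim (b≢a (trans (inverseʳ-unique a b (trans (sym h-11) hp≡ε))
                                               (sym (exponent2⇒self-inverse exponent2 a))))

    addC₂-cancel : ∀ i k → addC 2 i k ≡ 0F → i ≡ k
    addC₂-cancel 0F 0F _ = refl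
    addC₂-cancel 0F 1F ()
    addC₂-cancel 1F 0F ()
    addC₂-cancel 1F 1F _ = refl

    injective : ∀ {p q} → h p ≡ h q → p ≡ q
    injective {i , j} {k , l} hp≡hq with kernel (kleinOp (i , j) (k , l))
      (trans (hom (i , j) (k , l)) (trans (cong (_∙ h (k , l)) hp≡hq) (exponent2 (h (k , l)))))
    ... | pq≡0 = cong₂ _,_ (addC₂-cancel i k (cong proj₁ pq≡0)) (addC₂-cancel j l (cong proj₂ pq≡0))

    surjective : ∀ x → ∃[ p ] (h p ≡ x)
    surjective x with covered x
    ... | inj₁ refl               = (0F , 0F) , identityˡ ε
    ... | inj₂ (inj₁ refl)        = (1F , 0F) , h-10
    ... | inj₂ (inj₂ (inj₁ refl)) = (0F , 1F) , h-01
    ... | inj₂ (inj₂ (inj₂ refl)) = (1F , 1F) , h-11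

  nontrivial : 1 < n → ∃[ a ] (a ≢ ε)
  nontrivial 1<n with fromℕ< (<-trans (s≤s z≤n) 1<n) ≟ ε
  ... | no  0≢ε = _ , 0≢ε
  ... | yes 0≡ε = _ , λ 1≡ε → 0≢1 (cong toℕ (trans 0≡ε (sym 1≡ε)))
    where
    0≢1 : toℕ (fromℕ< (<-trans (s≤s z≤n) 1<n)) ≢ toℕ (fromℕ< 1<n)
    0≢1 rewrite toℕ-fromℕ< (<-trans (s≤s z≤n) 1<n) | toℕ-fromℕ< 1<n = λ ()

  module _ (squareFree : AutCardSquareFree G) where

    noDisjointTwins : ∀ {a b c d} → Unique (a ∷ b ∷ c ∷ d ∷ []) → Twins (Adj G) a b → Twins (Adj G) c d → ⊥
    noDisjointTwins distinct ab-twins cd-twins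
      with () ← proj₂ (proj₂ squareFree) 2
                  (disjointTwins⇒4∣card Adj-sym Adj-irrefl distinct ab-twins cd-twins (proj₁ (proj₂ squareFree)))

    module _ {x} (x²≢ε : x ∙ x ≢ ε) where

      private
        x≢ε : x ≢ ε
        x≢ε refl = x²≢ε (identityˡ ε)

        ≢⁻¹ : ∀ {z} → z ∙ z ≢ ε → z ≢ z ⁻¹
        ≢⁻¹ {z} z²≢ε z≡z⁻¹ = z²≢ε (trans (cong (z ∙_) z≡z⁻¹) (inverseʳ z))

        separated : ∀ {u v} → u ∈⟨ x ⟩ → ¬ v ∈⟨ x ⟩ → u ≢ v
        separated u∈ v∉ refl = v∉ u∈

        x⁻¹∈ : (x ⁻¹) ∈⟨ x ⟩
        x⁻¹∈ = ⁻¹-∈⟨⟩ ∈⟨self⟩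

      involution-outside : ∀ {z} → ¬ z ∈⟨ x ⟩ → z ∙ z ≡ ε
      involution-outside {z} z∉ with z ∙ z ≟ ε
      ... | yes z²≡ε = z²≡ε
      ... | no z²≢ε  = ⊥-elim (noDisjointTwins
        ((≢⁻¹ x²≢ε ∷ separated ∈⟨self⟩ z∉ ∷ separated ∈⟨self⟩ z⁻¹∉ ∷ []) ∷
         (separated x⁻¹∈ z∉ ∷ separated x⁻¹∈ z⁻¹∉ ∷ []) ∷ (≢⁻¹ z²≢ε ∷ []) ∷ [] ∷ [])
        (⁻¹-twins x) (⁻¹-twins z))
        where
        z⁻¹∉ : ¬ (z ⁻¹) ∈⟨ x ⟩
        z⁻¹∉ z⁻¹∈ = z∉ (subst (_∈⟨ x ⟩) (⁻¹-involutive z) (⁻¹-∈⟨⟩ z⁻¹∈))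

      generates : ∀ y → y ∈⟨ x ⟩
      generates y with ∈⟨⟩? y x
      ... | yes y∈ = y∈
      ... | no y∉  = ⊥-elim (noDisjointTwins
        ((≢⁻¹ x²≢ε ∷ separated ∈⟨self⟩ y∉ ∷ separated ∈⟨self⟩ xy∉ ∷ []) ∷
         (separated x⁻¹∈ y∉ ∷ separated x⁻¹∈ xy∉ ∷ []) ∷ (y≢xy ∷ []) ∷ [] ∷ [])
        (⁻¹-twins x)
        (pendant-twins (separated ε∈⟨⟩ y∉ ∘ sym) (separated ε∈⟨⟩ xy∉ ∘ sym) (pendant y∉) (pendant xy∉)))
        where
        pendant = outside⇒pendant (_∈⟨ x ⟩) ε∈⟨⟩ ∙-∈⟨⟩ involution-outside
        xy∉ : ¬ (x ∙ y) ∈⟨ x ⟩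
        xy∉ xy∈ = y∉ (subst (_∈⟨ x ⟩) (\\-leftDividesʳ x y) (∙-∈⟨⟩ x⁻¹∈ xy∈))
        y≢xy : y ≢ x ∙ y
        y≢xy y≡xy = x≢ε (identityˡ-unique x y (sym y≡xy))

      private
        order₃ : OrderAtLeast x 3
        order₃ 1 _ _ = x≢ε ∘ trans (sym (identityʳ x))
        order₃ 2 _ _ = x²≢ε ∘ trans (sym (cong (x ∙_) (identityʳ x)))
        order₃ (suc (suc (suc _))) _ (s≤s (s≤s (s≤s ())))

      cube≡ε : x ^ 3 ≡ ε
      cube≡ε with x ^ 3 ≟ ε
      ... | yes x³≡ε = x³≡ε
      ... | no x³≢ε  = ⊥-elim (noDisjointTwins (^-unique order₄) (cyclic⇒twins cyclic _ _) (cyclic⇒twins cyclic _ _))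
        where
        cyclic : Cyclic
        cyclic = x , generates
        order₄ : OrderAtLeast x 4
        order₄ 1 _ _ = order₃ 1 (s≤s z≤n) (s≤s (s≤s z≤n))
        order₄ 2 _ _ = order₃ 2 (s≤s z≤n) (s≤s (s≤s (s≤s z≤n)))
        order₄ 3 _ _ = x³≢ε
        order₄ (suc (suc (suc (suc _)))) _ (s≤s (s≤s (s≤s (s≤s ()))))

      ≅C₃ : IsoTo G (Fin 3) (addC 3)
      ≅C₃ = cyclic≅C 3 generates cube≡ε order₃

    module _ (exponent2 : Exponent2) {a} (a≢ε : a ≢ ε) where

      exponent2-classification : IsoTo G (Fin 2) (addC 2) ⊎ IsoTo G (Fin 2 × Fin 2) kleinOp
      exponent2-classification with any? (λ b → ¬? (b ≟ ε) ×-dec ¬? (b ≟ a))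
      ... | no ∄b = inj₁ (cyclic≅C 2 a-generates (^2≡ε (exponent2 a)) order₂)
        where
        a-generates : ∀ x → x ∈⟨ a ⟩
        a-generates x with x ≟ ε | x ≟ a
        ... | yes refl | _        = ε∈⟨⟩
        ... | no _     | yes refl = ∈⟨self⟩
        ... | no x≢ε   | no x≢a   = ⊥-elim (∄b (x , x≢ε , x≢a))
        order₂ : OrderAtLeast a 2
        order₂ 1 _ _ = a≢ε ∘ trans (sym (identityʳ a))
        order₂ (suc (suc _)) _ (s≤s (s≤s ()))
      ... | yes (b , b≢ε , b≢a)
        with any? (λ c → ¬? (c ≟ ε) ×-dec ¬? (c ≟ a) ×-dec ¬? (c ≟ b) ×-dec ¬? (c ≟ a ∙ b))
      ...   | yes (c , c≢ε , c≢a , c≢b , c≢ab) = ⊥-elim (noDisjointTwins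
        ((b≢a ∘ sym ∷ a≢ab ∷ c≢a ∘ sym ∷ []) ∷ (b≢ab ∷ c≢b ∘ sym ∷ []) ∷ (c≢ab ∘ sym ∷ []) ∷ [] ∷ [])
        (pendant-twins a≢ε b≢ε (exponent2⇒pendant exponent2 a≢ε) (exponent2⇒pendant exponent2 b≢ε))
        (pendant-twins ab≢ε c≢ε (exponent2⇒pendant exponent2 ab≢ε) (exponent2⇒pendant exponent2 c≢ε)))
        where
        a≢ab : a ≢ a ∙ b
        a≢ab a≡ab = b≢ε (identityʳ-unique a b (sym a≡ab))
        b≢ab : b ≢ a ∙ b
        b≢ab b≡ab = a≢ε (identityˡ-unique a b (sym b≡ab))
        ab≢ε : a ∙ b ≢ ε
        ab≢ε ab≡ε = b≢a (trans (inverseʳ-unique a b ab≡ε) (sym (exponent2⇒self-inverse exponent2 a)))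
      ...   | no ∄c = inj₂ (exponent2≅V₄ exponent2 a≢ε b≢ε b≢a covered)
        where
        covered : ∀ x → x ≡ ε ⊎ x ≡ a ⊎ x ≡ b ⊎ x ≡ a ∙ b
        covered x with x ≟ ε | x ≟ a | x ≟ b | x ≟ a ∙ b
        ... | yes x≡ε | _       | _       | _        = inj₁ x≡ε
        ... | no _    | yes x≡a | _       | _        = inj₂ (inj₁ x≡a)
        ... | no _    | no _    | yes x≡b | _        = inj₂ (inj₂ (inj₁ x≡b))
        ... | no _    | no _    | no _    | yes x≡ab = inj₂ (inj₂ (inj₂ x≡ab))
        ... | no x≢ε  | no x≢a  | no x≢b  | no x≢ab  = ⊥-elim (∄c (x , x≢ε , x≢a , x≢b , x≢ab))

    classification : 1 < n →
                     IsoTo G (Fin 2) (addC 2) ⊎ IsoTo G (Fin 3) (addC 3) ⊎ IsoTo G (Fin 2 × Fin 2) kleinOp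
    classification 1<n with all? (λ z → z ∙ z ≟ ε)
    ... | yes exponent2 = Sum.map₂ inj₂ (exponent2-classification exponent2 (proj₂ (nontrivial 1<n)))
    ... | no ¬exponent2 = inj₂ (inj₁ (≅C₃ (proj₂ (¬∀⟶∃¬ n _ (λ z → z ∙ z ≟ ε) ¬exponent2))))

  module _ {A : Set} (_·_ : A → A → A) (φ : IsoTo G A _·_) where
    open Inverse (proj₁ φ)

    iso-injective : ∀ {x y} → to x ≡ to y → x ≡ y
    iso-injective {x} {y} tx≡ty = trans (sym (strictlyInverseʳ x)) (trans (cong from tx≡ty) (strictlyInverseʳ y))

    iso-identity : ∀ {e} → (∀ a → a · a ≡ a → a ≡ e) → to ε ≡ e
    iso-identity idempotent = idempotent (to ε) (trans (sym (proj₂ φ ε ε)) (cong to (identityˡ ε)))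

  cyclic⇒|Aut|≡n! : Cyclic → HasCard (AutSetoid G) (n !)
  cyclic⇒|Aut|≡n! cyclic = Compose.inverse (automorphisms-transport (↔-id _) (cyclic⇒Adj⇔≢ cyclic))
                             (Compose.inverse ≢-automorphisms≅permutations (|Permutation|≡! n))

  C₂⇒cyclic : IsoTo G (Fin 2) (addC 2) → Cyclic
  C₂⇒cyclic φ = g , λ x → toℕ (to x) , iso-injective (addC 2) φ (powers (to x))
    where
    open Inverse (proj₁ φ)
    g = from 1F
    to-ε≡0 : to ε ≡ 0F
    to-ε≡0 = iso-identity (addC 2) φ λ { 0F _ → refl ; 1F () }
    powers : ∀ i → to (g ^ toℕ i) ≡ i
    powers 0F = to-ε≡0
    powers 1F = trans (proj₂ φ g ε) (cong₂ (addC 2) (strictlyInverseˡ 1F) to-ε≡0)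

  C₃⇒cyclic : IsoTo G (Fin 3) (addC 3) → Cyclic
  C₃⇒cyclic φ = g , λ x → toℕ (to x) , iso-injective (addC 3) φ (powers (to x))
    where
    open Inverse (proj₁ φ)
    g = from 1F
    to-ε≡0 : to ε ≡ 0F
    to-ε≡0 = iso-identity (addC 3) φ λ { 0F _ → refl ; 1F () ; 2F () }
    powers : ∀ i → to (g ^ toℕ i) ≡ i
    powers 0F = to-ε≡0
    powers 1F = trans (proj₂ φ g ε) (cong₂ (addC 3) (strictlyInverseˡ 1F) to-ε≡0)
    powers 2F = trans (proj₂ φ g (g ^ 1)) (cong₂ (addC 3) (strictlyInverseˡ 1F) (powers 1F))

  V₄⇒|Aut|≡3! : IsoTo G (Fin 2 × Fin 2) kleinOp → HasCard (AutSetoid G) (3 !)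
  V₄⇒|Aut|≡3! φ = Compose.inverse (automorphisms-transport θ Adj⇔Star₀)
                    (Compose.inverse (star-automorphisms≅permutations 1) (|Permutation|≡! 3))
    where
    open Inverse (proj₁ φ)
    klein-square : ∀ p → kleinOp p p ≡ (0F , 0F)
    klein-square (0F , 0F) = refl
    klein-square (0F , 1F) = refl
    klein-square (1F , 0F) = refl
    klein-square (1F , 1F) = refl
    to-ε≡0 : to ε ≡ (0F , 0F)
    to-ε≡0 = iso-identity kleinOp φ λ p pp≡p → trans (sym pp≡p) (klein-square p)
    exponent2 : Exponent2
    exponent2 z = iso-injective kleinOp φ (trans (proj₂ φ z z) (trans (klein-square (to z)) (sym to-ε≡0)))
    θ : Fin n ↔ Fin 4
    θ = ↔-sym *↔× Compose.↔-∘ proj₁ φ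
    Adj⇔Star₀ : ∀ x y → Adj G x y ⇔ Star 0F (Inverse.to θ x) (Inverse.to θ y)
    Adj⇔Star₀ x y = Star-preserved (proj₁ (inverseᵇ⇒bijective (Inverse.inverse θ)))
                                   (cong (Inverse.to (↔-sym *↔×)) to-ε≡0) x y
                      Compose.⇔-∘ exponent2⇒Adj⇔Star exponent2 x y

mainTheorem12 : (n : ℕ) (G : FinGroup n) → 1 < n →
    AutCardSquareFree G ⇔
      (IsoTo G (Fin 2) (addC 2) ⊎ IsoTo G (Fin 3) (addC 3) ⊎ IsoTo G (Fin 2 × Fin 2) kleinOp)
mainTheorem12 n G 1<n = mk⇔ (λ squareFree → classification squareFree 1<n) λ
  { (inj₁ φ)        → n ! , cyclic⇒|Aut|≡n! (C₂⇒cyclic φ) , order-invariant (proj₁ φ) (from-yes (squareFree? 2))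
  ; (inj₂ (inj₁ φ)) → n ! , cyclic⇒|Aut|≡n! (C₃⇒cyclic φ) , order-invariant (proj₁ φ) (from-yes (squareFree? 6))
  ; (inj₂ (inj₂ φ)) → 3 ! , V₄⇒|Aut|≡3! φ , from-yes (squareFree? 6) }
  where
  open EnhancedPowerGraph G
  order-invariant : ∀ {m} → Fin n ↔ Fin m → SquareFree (m !) → SquareFree (n !)
  order-invariant θ = subst (SquareFree ∘ _!) (sym (↔⇒≡ θ))
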